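{- If $P$ is a rooted star poset with $n$ elements, then $\deg(\partial)=n$.
   Context: A labeling of an $n$-element poset $P$ is a bijection $L:P\to[n]$; $\Lambda(P)$ denotes the set of labelings. Extended promotion $\partial:\Lambda(P)\to\Lambda(P)$: for a labeling $L$, the promotion chain is $v_1=L^{ -1}(1)$, and $v_{i+1}$ is the element above $v_i$ with smallest label, stopping at the first maximal element $v_m$; then $\partial(L)(x)=L(x)-1$ for $x$ off the chain, $\partial(L)(v_i)=L(v_{i+1})-1$ for $i<m$, $\partial(L)(v_m)=n$. The degree of noninvertibility of a map $f:X\to X$ on a finite set is $\deg(f)=\frac{1}{|X|}\sum_{x\in X}|f^{ -1}(x)|^2$. A rooted tree poset is a connected poset in which each element is covered by at most one other element; a rooted star poset is a rooted tree poset whose root covers every leaf. -}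

module Defs where

open import Data.Bool using (Bool; true; false; if_then_else_; _∧_)
open import Data.Nat using (ℕ; zero; suc; _+_; _*_)
open import Data.Fin using (Fin; zero; suc; fromℕ; pred; toℕ; _<?_) renaming (_≟_ to _≟ᶠ_)
open import Data.List using (List; []; _∷_; [_]; filter; filterᵇ; length; map; concatMap; allFin)
open import Data.Bool.ListAction using (and)
open import Data.Nat.ListAction using (sum)
open import Data.Maybe using (Maybe; just; nothing)
open import Data.Vec using (Vec; []; _∷_; lookup; tabulate; toList)
open import Data.Vec.Properties using (≡-dec)
open import Data.Integer using (+_)
open import Data.Rational using (ℚ; _/_; 0ℚ)
open import Data.Product using (Σ; _×_; _,_)
open import Data.Sum using (_⊎_)
open import Relation.Binary.Core using (Rel)
open import Relation.Binary.Definitions using (DecidableEquality)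
open import Relation.Binary.Structures using (IsDecPartialOrder)
open import Relation.Binary.PropositionalEquality using (_≡_; _≢_)
open import Relation.Binary.Construct.Closure.ReflexiveTransitive using (Star)
open import Relation.Nullary using (¬_; does)
open import Level using (0ℓ)

-- Degree of noninvertibility of f : X → X on a finite set X, where X is
-- given as a duplicate-free list `xs` of its elements (A has decidable
-- equality).  deg f = (1/|X|) Σ_{x ∈ X} |f⁻¹(x)|².
-- (Convention: for X = ∅ the value is 0; never used below since Λ(P) ≠ ∅.)

module _ {A : Set} (_≟_ : DecidableEquality A) where

  preimageSize : (xs : List A) → (A → A) → A → ℕ
  preimageSize xs f x = length (filter (λ y → f y ≟ x) xs)

  deg : (xs : List A) → (A → A) → ℚ
  deg xs f with length xs
  ... | zero  = 0ℚ
  ... | suc k = (+ sum (map (λ x → preimageSize xs f x * preimageSize xs f x) xs)) / suc k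

record FinPoset (n : ℕ) : Set₁ where
  field
    _≤_ : Rel (Fin n) 0ℓ
    isDecPartialOrder : IsDecPartialOrder _≡_ _≤_
  open IsDecPartialOrder isDecPartialOrder public using (_≤?_)

module _ {n : ℕ} (P : FinPoset n) where
  open FinPoset P

  _<ₚ_ : Rel (Fin n) 0ℓ
  x <ₚ y = x ≤ y × x ≢ y

  _⋖_ : Rel (Fin n) 0ℓ
  x ⋖ y = x <ₚ y × (∀ z → ¬ (x <ₚ z × z <ₚ y))

  IsMaximal : Fin n → Set
  IsMaximal x = ∀ y → ¬ (x <ₚ y)

  IsMinimal : Fin n → Set
  IsMinimal x = ∀ y → ¬ (y <ₚ x)

  -- connected: nonempty, and the comparability graph is connected
  Connected : Set
  Connected = Fin n × (∀ x y → Star (λ a b → a ≤ b ⊎ b ≤ a) x y)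

  IsRootedTree : Set
  IsRootedTree = Connected × (∀ x y z → x ⋖ y → x ⋖ z → y ≡ z)

  IsRootedStar : Set
  IsRootedStar = IsRootedTree ×
    (∀ r → IsMaximal r → ∀ l → IsMinimal l → l ≢ r → l ⋖ r)

  aboveᵇ : Fin n → Fin n → Bool
  aboveᵇ x y = does (x ≤? y) ∧ Data.Bool.not (does (x ≟ᶠ y))

-- Labelings: a labeling L : P → [n] is stored as the vector of labels
-- (entry x is the label of x, label i+1 is represented by i : Fin n).

Labeling : ℕ → Set
Labeling n = Vec (Fin n) n

allVecs : (n k : ℕ) → List (Vec (Fin n) k)
allVecs n zero    = [ [] ]
allVecs n (suc k) = concatMap (λ a → map (a ∷_) (allVecs n k)) (allFin n)

isBijectionᵇ : {n : ℕ} → Labeling n → Bool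
isBijectionᵇ {n} L =
  and (map (λ j → does (Data.Nat._≟_ (length (filter (λ x → lookup L x ≟ᶠ j) (allFin n))) 1))
                (allFin n))

Λ : {n : ℕ} → FinPoset n → List (Labeling n)
Λ {n} P = filterᵇ isBijectionᵇ (allVecs n n)

module Promotion {m : ℕ} (P : FinPoset (suc m)) (L : Labeling (suc m)) where
  N = suc m

  label : Fin N → Fin N
  label x = lookup L x

  argminLabel : List (Fin N) → Maybe (Fin N)
  argminLabel []       = nothing
  argminLabel (x ∷ xs) with argminLabel xs
  ... | nothing = just x
  ... | just y  = if does (label y <? label x) then just y else just x

  next : Fin N → Maybe (Fin N)
  next v = argminLabel (filterᵇ (aboveᵇ P v) (allFin N))

  -- the chain v, v', v'', ... up to the first maximal element
  -- (fuel N suffices, as the chain is strictly increasing)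
  chainFrom : ℕ → Fin N → List (Fin N)
  chainFrom zero    v = [ v ]
  chainFrom (suc k) v with next v
  ... | nothing = [ v ]
  ... | just w  = v ∷ chainFrom k w

  v₁ : Fin N
  v₁ with filter (λ x → label x ≟ᶠ zero) (allFin N)
  ... | []    = zero
  ... | x ∷ _ = x

  chain : List (Fin N)
  chain = chainFrom N v₁

  newLabel : List (Fin N) → Fin N → Fin N
  newLabel []            x = pred (label x)
  newLabel (v ∷ [])      x = if does (x ≟ᶠ v) then fromℕ m else pred (label x)
  newLabel (v ∷ w ∷ rest) x = if does (x ≟ᶠ v) then pred (label w) else newLabel (w ∷ rest) x

  result : Labeling N
  result = tabulate (newLabel chain)

∂ : {n : ℕ} → FinPoset n → Labeling n → Labeling n
∂ {zero}  P L = L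
∂ {suc m} P L = Promotion.result P L

degPromotion : {n : ℕ} → FinPoset n → ℚ
degPromotion {n} P = deg (≡-dec _≟ᶠ_) (Λ P) (∂ P)

{-# OPTIONS --safe #-}
module Submission where

-- In a rooted star every element other than the root is covered by the root and by nothing
-- else.  So the promotion chain of L is v₁ followed by the root (just the root if
-- v₁ is the root), and off the root ∂ L is L composed with the transposition of v₁ and the root,
-- lowered by one; the root gets label n.  Hence L is determined by ∂ L together with the position
-- v₁ of its label 1, and each of the n positions occurs: every fibre of ∂ over its image has n
-- elements, and Σ_y |∂⁻¹ y|² = Σ_L |∂⁻¹ (∂ L)| = n |Λ(P)|.

open import Defs
open import Data.Bool using (Bool; true; false; T; T?)
open import Data.Bool.Properties using (if-eta)
open import Data.Fin using (Fin; zero; suc; fromℕ; pred; punchOut; _<?_) renaming (_≟_ to _≟ᶠ_)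
open import Data.Fin.Permutation.Components using (transpose; transpose-inverse)
open import Data.Fin.Properties
  using (any?; punchOut-injective; injective⇒≤; inject₁-injective; fromℕ≢inject₁)
open import Data.Integer using (+_)
import Data.Integer as ℤ
open import Data.Integer.Properties using (pos-*)
open import Data.List
  using (List; []; _∷_; [_]; _++_; length; map; filter; concatMap; cartesianProductWith; allFin)
open import Data.List.Membership.Propositional using (_∈_)
open import Data.List.Membership.Propositional.Properties
  using ( ∈-∃++; ∈-++⁻; ∈-++⁺ˡ; ∈-++⁺ʳ; ∈-filter⁺; ∈-filter⁻; ∈-allFin; ∈-map⁺; ∈-map⁻; ∈-length
        ; ∈-cartesianProductWith⁺)
open import Data.List.Properties using (length-++-sucʳ; length-map; length-tabulate; map-cong-local; filter-none)
open import Data.List.Relation.Binary.Subset.Propositional using (_⊆_)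
open import Data.List.Relation.Unary.All as All using (All; []; _∷_)
open import Data.List.Relation.Unary.All.Properties using (all⁺; all⁻; all-filter)
open import Data.List.Relation.Unary.AllPairs using ([]; _∷_)
open import Data.List.Relation.Unary.Any using (here; there)
open import Data.List.Relation.Unary.Unique.Propositional using (Unique)
open import Data.List.Relation.Unary.Unique.Propositional.Properties
  using (allFin⁺; filter⁺; map⁺; cartesianProductWith⁺)
open import Data.Maybe using (just; nothing)
open import Data.Nat using (ℕ; zero; suc; _+_; _*_; _≤_; _<_; z≤n; s≤s) renaming (_≟_ to _≟ℕ_)
open import Data.Nat.Induction using (<-wellFounded)
open import Data.Nat.ListAction using (sum)
import Data.Nat.Properties as ℕ
open import Algebra.Properties.CommutativeSemigroup ℕ.+-commutativeSemigroup using (interchange)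
open import Data.Product using (∃; _×_; _,_; proj₁; proj₂)
open import Data.Rational using (_/_)
open import Data.Rational.Properties using (fromℚᵘ-cong)
open import Data.Rational.Unnormalised using (mkℚᵘ; *≡*)
open import Data.Sum using (_⊎_; inj₁; inj₂)
open import Data.Vec using (Vec; []; _∷_; lookup; tabulate) renaming (allFin to allFinᵛ)
open import Data.Vec.Properties
  using (∷-injective; lookup∘tabulate; tabulate∘lookup; tabulate-cong; lookup-allFin; ≡-dec)
open import Function using (_∘_; flip)
open import Function.Definitions using (Injective)
open import Induction.WellFounded using (Acc; acc)
open import Level using (0ℓ)
open import Relation.Binary.Core using (Rel)
open import Relation.Binary.Definitions using (DecidableEquality; Decidable; Transitive)
open import Relation.Binary.PropositionalEquality
  using (_≡_; _≢_; _≗_; refl; sym; trans; cong; cong₂; subst; module ≡-Reasoning)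
open import Relation.Binary.Structures using (IsDecPartialOrder)
import Relation.Binary.Construct.NonStrictToStrict as NonStrictToStrict
open import Relation.Nullary using (¬_; Dec; yes; no; does; contradiction)
open import Relation.Nullary.Decidable using (dec-true; dec-false)

module _ {A : Set} where

  length-mono-Unique : ∀ {xs ys : List A} → Unique xs → xs ⊆ ys → length xs ≤ length ys
  length-mono-Unique {[]}     _            _   = z≤n
  length-mono-Unique {x ∷ xs} (x∉xs ∷ xs!) xs⊆ys with ys₁ , ys₂ , refl ← ∈-∃++ (xs⊆ys (here refl)) =
    subst (suc (length xs) ≤_) (sym (length-++-sucʳ ys₁ x ys₂)) (s≤s (length-mono-Unique xs! xs⊆ys₁ys₂))
    where
      xs⊆ys₁ys₂ : xs ⊆ ys₁ ++ ys₂
      xs⊆ys₁ys₂ z∈xs with ∈-++⁻ ys₁ (xs⊆ys (there z∈xs))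
      ... | inj₁ z∈ys₁          = ∈-++⁺ˡ z∈ys₁
      ... | inj₂ (here refl)    = contradiction refl (All.lookup x∉xs z∈xs)
      ... | inj₂ (there z∈ys₂) = ∈-++⁺ʳ ys₁ z∈ys₂

  length-≡-Unique : ∀ {xs ys : List A} → Unique xs → Unique ys → xs ⊆ ys → ys ⊆ xs →
                    length xs ≡ length ys
  length-≡-Unique xs! ys! xs⊆ys ys⊆xs =
    ℕ.≤-antisym (length-mono-Unique xs! xs⊆ys) (length-mono-Unique ys! ys⊆xs)

  sum-map-+ : ∀ (f g : A → ℕ) xs →
              sum (map (λ x → f x + g x) xs) ≡ sum (map f xs) + sum (map g xs)
  sum-map-+ f g []       = refl
  sum-map-+ f g (x ∷ xs) =
    trans (cong (_+_ (f x + g x)) (sum-map-+ f g xs)) (interchange (f x) (g x) _ _)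

  sum-map-const : ∀ (f : A → ℕ) {c} xs → (∀ {x} → x ∈ xs → f x ≡ c) → sum (map f xs) ≡ length xs * c
  sum-map-const f []       _     = refl
  sum-map-const f (x ∷ xs) fxs≡c = cong₂ _+_ (fxs≡c (here refl)) (sum-map-const f xs (fxs≡c ∘ there))

  concatMap-map≡cartesianProductWith : ∀ {B C : Set} (f : A → B → C) xs ys →
    concatMap (λ x → map (f x) ys) xs ≡ cartesianProductWith f xs ys
  concatMap-map≡cartesianProductWith f []       ys = refl
  concatMap-map≡cartesianProductWith f (x ∷ xs) ys =
    cong (map (f x) ys ++_) (concatMap-map≡cartesianProductWith f xs ys)

-- The degree of noninvertibility of a map with constant fibres

*-/-cancelˡ : ∀ k c → (+ (suc k * c)) / suc k ≡ (+ c) / 1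
*-/-cancelˡ k c = fromℚᵘ-cong {mkℚᵘ (+ (suc k * c)) k} {mkℚᵘ (+ c) 0} (*≡* (begin
  + (suc k * c) ℤ.* + 1 ≡⟨ pos-* (suc k * c) 1 ⟨
  + (suc k * c * 1)     ≡⟨ cong +_ (trans (ℕ.*-identityʳ _) (ℕ.*-comm (suc k) c)) ⟩
  + (c * suc k)         ≡⟨ pos-* c (suc k) ⟩
  + c ℤ.* + suc k       ∎))
  where open ≡-Reasoning

module _ {A : Set} (_≟_ : DecidableEquality A) where

  private
    select : A → (A → ℕ) → A → ℕ
    select a g y with does (a ≟ y)
    ... | true  = g y
    ... | false = 0

    sum-select : ∀ g {a} {ys} → Unique ys → a ∈ ys → sum (map (select a g) ys) ≡ g a
    sum-select g {a} {y ∷ ys} (y∉ys ∷ ys!) (here refl) rewrite dec-true (a ≟ a) refl =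
      trans (cong (_+_ (g a)) rest≡0) (ℕ.+-identityʳ (g a))
      where
        miss : ∀ {z} → a ≢ z → select a g z ≡ 0
        miss {z} a≢z rewrite dec-false (a ≟ z) a≢z = refl
        rest≡0 : sum (map (select a g) ys) ≡ 0
        rest≡0 = trans (sum-map-const (select a g) ys (All.lookup (All.map miss y∉ys)))
                       (ℕ.*-zeroʳ (length ys))
    sum-select g {a} {y ∷ ys} (y∉ys ∷ ys!) (there a∈ys)
      rewrite dec-false (a ≟ y) (λ { refl → All.lookup y∉ys a∈ys refl }) = sum-select g ys! a∈ys

    preimageSize-∷ : ∀ f g z zs y →
      preimageSize _≟_ (z ∷ zs) f y * g y ≡ select (f z) g y + preimageSize _≟_ zs f y * g y
    preimageSize-∷ f g z zs y with does (f z ≟ y)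
    ... | true  = refl
    ... | false = refl

  sum-preimageSize-* : ∀ (f : A → A) (g : A → ℕ) {ys} zs → Unique ys → (∀ {z} → z ∈ zs → f z ∈ ys) →
                       sum (map (λ y → preimageSize _≟_ zs f y * g y) ys) ≡ sum (map (g ∘ f) zs)
  sum-preimageSize-* f g {ys} [] _ _ =
    trans (sum-map-const (λ _ → 0) ys (λ _ → refl)) (ℕ.*-zeroʳ (length ys))
  sum-preimageSize-* f g {ys} (z ∷ zs) ys! f∈ys = begin
    sum (map (λ y → preimageSize _≟_ (z ∷ zs) f y * g y) ys)
      ≡⟨ cong sum (map-cong-local {xs = ys} (All.tabulate (λ {y} _ → preimageSize-∷ f g z zs y))) ⟩
    sum (map (λ y → select (f z) g y + preimageSize _≟_ zs f y * g y) ys)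
      ≡⟨ sum-map-+ (select (f z) g) (λ y → preimageSize _≟_ zs f y * g y) ys ⟩
    sum (map (select (f z) g) ys) + sum (map (λ y → preimageSize _≟_ zs f y * g y) ys)
      ≡⟨ cong₂ _+_ (sum-select g ys! (f∈ys (here refl)))
                   (sum-preimageSize-* f g zs ys! (f∈ys ∘ there)) ⟩
    g (f z) + sum (map (g ∘ f) zs) ∎
    where open ≡-Reasoning

  sum-preimageSize² : ∀ {xs} {f : A → A} {c} → Unique xs → (∀ {x} → x ∈ xs → f x ∈ xs) →
    (∀ {x} → x ∈ xs → preimageSize _≟_ xs f (f x) ≡ c) →
    sum (map (λ y → preimageSize _≟_ xs f y * preimageSize _≟_ xs f y) xs) ≡ length xs * c
  sum-preimageSize² {xs} {f} xs! f∈xs fibre≡c =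
    trans (sum-preimageSize-* f p xs xs! f∈xs) (sum-map-const (p ∘ f) xs fibre≡c)
    where
      p : A → ℕ
      p = preimageSize _≟_ xs f

  deg-constant-fibres : ∀ {xs} {f : A → A} {c} → Unique xs → (∀ {x} → x ∈ xs → f x ∈ xs) →
    (∀ {x} → x ∈ xs → preimageSize _≟_ xs f (f x) ≡ c) → ∀ {x} → x ∈ xs →
    deg _≟_ xs f ≡ (+ c) / 1
  deg-constant-fibres {xs} {f} {c} xs! f∈xs fibre≡c x∈xs
    with length xs | sum-preimageSize² xs! f∈xs fibre≡c | ∈-length x∈xs
  ... | suc k | Σ≡ | _ = trans (cong (λ s → (+ s) / suc k) Σ≡) (*-/-cancelˡ k c)

allVecs-suc : ∀ n k → allVecs n (suc k) ≡ cartesianProductWith _∷_ (allFin n) (allVecs n k)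
allVecs-suc n k = concatMap-map≡cartesianProductWith _∷_ (allFin n) (allVecs n k)

allVecs-unique : ∀ n k → Unique (allVecs n k)
allVecs-unique n zero    = [] ∷ []
allVecs-unique n (suc k) = subst Unique (sym (allVecs-suc n k))
  (cartesianProductWith⁺ _∷_ ∷-injective (allFin⁺ n) (allVecs-unique n k))

∈-allVecs : ∀ {n k} (v : Vec (Fin n) k) → v ∈ allVecs n k
∈-allVecs []                = here refl
∈-allVecs {n} {suc k} (a ∷ v) = subst (a ∷ v ∈_) (sym (allVecs-suc n k))
  (∈-cartesianProductWith⁺ _∷_ (∈-allFin a) (∈-allVecs v))

injective⇒surjective : ∀ {n} {f : Fin n → Fin n} → Injective _≡_ _≡_ f → ∀ j → ∃ λ i → f i ≡ j
injective⇒surjective {suc n} {f} f-inj j with any? (λ i → f i ≟ᶠ j)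
... | yes hit = hit
... | no miss = contradiction (injective⇒≤ punchOut∘f-injective) ℕ.1+n≰n
  where
    punchOut∘f : Fin (suc n) → Fin n
    punchOut∘f i = punchOut {i = j} (λ j≡fi → miss (i , sym j≡fi))
    punchOut∘f-injective : Injective _≡_ _≡_ punchOut∘f
    punchOut∘f-injective {x} {y} =
      f-inj ∘ punchOut-injective (λ j≡fx → miss (x , sym j≡fx)) (λ j≡fy → miss (y , sym j≡fy))

module _ {n : ℕ} (L : Labeling n) where

  private
    withLabel : Fin n → List (Fin n)
    withLabel j = filter (λ x → lookup L x ≟ᶠ j) (allFin n)

    withLabel-unique : ∀ j → Unique (withLabel j)
    withLabel-unique j = filter⁺ (λ x → lookup L x ≟ᶠ j) (allFin⁺ n)

    labelled-once? : Fin n → Bool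
    labelled-once? j = does (length (withLabel j) ≟ℕ 1)

  isBijectionᵇ⇒injective : T (isBijectionᵇ L) → Injective _≡_ _≡_ (lookup L)
  isBijectionᵇ⇒injective bij {x} {y} Lx≡Ly with x ≟ᶠ y
  ... | yes x≡y = x≡y
  ... | no x≢y  = contradiction (subst (2 ≤_) (labelled-once (lookup L x)) two-labelled) ℕ.1+n≰n
    where
      labelled-once : ∀ j → length (withLabel j) ≡ 1
      labelled-once j = ℕ.≡ᵇ⇒≡ _ 1 (All.lookup (all⁺ labelled-once? (allFin n) bij) (∈-allFin j))
      two-labelled : 2 ≤ length (withLabel (lookup L x))
      two-labelled = length-mono-Unique ((x≢y ∷ []) ∷ [] ∷ []) λ
        { (here refl)         → ∈-filter⁺ (λ z → lookup L z ≟ᶠ lookup L x) (∈-allFin x) refl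
        ; (there (here refl)) → ∈-filter⁺ (λ z → lookup L z ≟ᶠ lookup L x) (∈-allFin y) (sym Lx≡Ly) }

  injective⇒isBijectionᵇ : Injective _≡_ _≡_ (lookup L) → T (isBijectionᵇ L)
  injective⇒isBijectionᵇ inj =
    all⁻ labelled-once? {xs = allFin n} (All.tabulate (λ {j} _ → ℕ.≡⇒≡ᵇ _ 1 (labelled-once j)))
    where
      labelled-once : ∀ j → length (withLabel j) ≡ 1
      labelled-once j with x , Lx≡j ← injective⇒surjective inj j =
        length-≡-Unique (withLabel-unique j) ([] ∷ [])
          (λ z∈ → here (inj (trans (proj₂ (∈-filter⁻ (λ z → lookup L z ≟ᶠ j) {xs = allFin n} z∈))
                                   (sym Lx≡j))))
          (λ { (here refl) → ∈-filter⁺ (λ z → lookup L z ≟ᶠ j) (∈-allFin x) Lx≡j })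

module _ {n : ℕ} (P : FinPoset n) where

  Λ-unique : Unique (Λ P)
  Λ-unique = filter⁺ (T? ∘ isBijectionᵇ) (allVecs-unique n n)

  ∈Λ⇒injective : ∀ {L} → L ∈ Λ P → Injective _≡_ _≡_ (lookup L)
  ∈Λ⇒injective {L} L∈Λ =
    isBijectionᵇ⇒injective L (proj₂ (∈-filter⁻ (T? ∘ isBijectionᵇ) {xs = allVecs n n} L∈Λ))

  injective⇒∈Λ : ∀ {L} → Injective _≡_ _≡_ (lookup L) → L ∈ Λ P
  injective⇒∈Λ {L} inj = ∈-filter⁺ (T? ∘ isBijectionᵇ) (∈-allVecs L) (injective⇒isBijectionᵇ L inj)

  id∈Λ : allFinᵛ n ∈ Λ P
  id∈Λ = injective⇒∈Λ (λ {i} {j} e → trans (sym (lookup-allFin i)) (trans e (lookup-allFin j)))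

module _ {n : ℕ} {_≺_ : Rel (Fin n) 0ℓ}
         (≺-trans : Transitive _≺_) (≺-irrefl : ∀ {x} → ¬ x ≺ x) (_≺?_ : Decidable _≺_) where

  private
    above : Fin n → List (Fin n)
    above x = filter (x ≺?_) (allFin n)

    above-shrinks : ∀ {x y} → x ≺ y → length (above y) < length (above x)
    above-shrinks {x} {y} x≺y =
      length-mono-Unique (All.map (λ { y≺z refl → ≺-irrefl y≺z }) (all-filter (y ≺?_) (allFin n))
                          ∷ filter⁺ (y ≺?_) (allFin⁺ n)) λ
        { (here refl) → ∈-filter⁺ (x ≺?_) (∈-allFin y) x≺y
        ; (there z∈)  → ∈-filter⁺ (x ≺?_) (∈-allFin _)
                          (≺-trans x≺y (proj₂ (∈-filter⁻ (y ≺?_) {xs = allFin n} z∈))) }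

    maximal-above-acc : ∀ x → Acc _<_ (length (above x)) →
                        ∃ λ t → (x ≡ t ⊎ x ≺ t) × (∀ y → ¬ t ≺ y)
    maximal-above-acc x (acc rec) with any? (x ≺?_)
    ... | no ¬x≺ = x , inj₁ refl , λ y x≺y → ¬x≺ (y , x≺y)
    ... | yes (y , x≺y) with maximal-above-acc y (rec (above-shrinks x≺y))
    ...   | t , inj₁ refl , t-max = t , inj₂ x≺y , t-max
    ...   | t , inj₂ y≺t  , t-max = t , inj₂ (≺-trans x≺y y≺t) , t-max

  maximal-above : ∀ x → ∃ λ t → (x ≡ t ⊎ x ≺ t) × (∀ y → ¬ t ≺ y)
  maximal-above x = maximal-above-acc x (<-wellFounded _)

module _ {n : ℕ} (P : FinPoset n) where
  open FinPoset P using (isDecPartialOrder; _≤?_) renaming (_≤_ to _≤ₚ_)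
  open IsDecPartialOrder isDecPartialOrder using (isPartialOrder)
  open NonStrictToStrict _≡_ _≤ₚ_ using (<-trans; <-irrefl; <-decidable)

  <ₚ-trans : Transitive (_<ₚ_ P)
  <ₚ-trans = <-trans isPartialOrder

  <ₚ-irrefl : ∀ {x} → ¬ _<ₚ_ P x x
  <ₚ-irrefl = <-irrefl refl

  maximal-element-above : ∀ x → ∃ λ t → (x ≡ t ⊎ _<ₚ_ P x t) × IsMaximal P t
  maximal-element-above = maximal-above <ₚ-trans <ₚ-irrefl (<-decidable _≟ᶠ_ _≤?_)

  minimal-element-below : ∀ x → ∃ λ t → (x ≡ t ⊎ _<ₚ_ P t x) × IsMinimal P t
  minimal-element-below = maximal-above (flip <ₚ-trans) <ₚ-irrefl (flip (<-decidable _≟ᶠ_ _≤?_))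

  aboveᵇ-sound : ∀ {x y} → T (aboveᵇ P x y) → _<ₚ_ P x y
  aboveᵇ-sound {x} {y} t with x ≤? y | x ≟ᶠ y
  ... | yes x≤y | no x≢y = x≤y , x≢y

  aboveᵇ-complete : ∀ {x y} → _<ₚ_ P x y → T (aboveᵇ P x y)
  aboveᵇ-complete {x} {y} (x≤y , x≢y) with x ≤? y | x ≟ᶠ y
  ... | yes _   | no _    = _
  ... | no x≰y  | _       = x≰y x≤y
  ... | yes _   | yes x≡y = x≢y x≡y

module RootedStar {n : ℕ} (P : FinPoset n) (star : IsRootedStar P) where

  private
    _⊏_ : Rel (Fin n) 0ℓ
    _⊏_ = _<ₚ_ P

    covers-unique : ∀ x y z → _⋖_ P x y → _⋖_ P x z → y ≡ z
    covers-unique = proj₂ (proj₁ star)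

    maximal-covers-leaves : ∀ r → IsMaximal P r → ∀ l → IsMinimal P l → l ≢ r → _⋖_ P l r
    maximal-covers-leaves = proj₂ star

  -- Connectivity is only needed to know that P is nonempty.
  root : Fin n
  root = proj₁ (maximal-element-above P (proj₁ (proj₁ (proj₁ star))))

  root-maximal : IsMaximal P root
  root-maximal = proj₂ (proj₂ (maximal-element-above P (proj₁ (proj₁ (proj₁ star)))))

  -- A leaf below a second maximal element t would be covered by both t and the root.
  maximal⇒root : ∀ {t} → IsMaximal P t → t ≡ root
  maximal⇒root {t} t-max with t ≟ᶠ root | minimal-element-below P t
  ... | yes t≡root | _ = t≡root
  ... | no t≢root  | _ , inj₁ refl , t-min =
    contradiction (proj₁ (maximal-covers-leaves root root-maximal t t-min t≢root)) (t-max root)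
  ... | no t≢root  | l , inj₂ l⊏t , l-min =
    covers-unique l t root (maximal-covers-leaves t t-max l l-min (proj₂ l⊏t))
                           (maximal-covers-leaves root root-maximal l l-min l≢root)
    where
      l≢root : l ≢ root
      l≢root refl = root-maximal t l⊏t

  below-root : ∀ {x} → x ≢ root → x ⊏ root
  below-root {x} x≢root with maximal-element-above P x
  ... | _ , inj₁ refl , x-max = contradiction (maximal⇒root x-max) x≢root
  ... | t , inj₂ x⊏t  , t-max = subst (x ⊏_) (maximal⇒root t-max) x⊏t

  -- The root covers a leaf l below x, so no y with l < y lies strictly below the root.
  above⇒root : ∀ {x y} → x ⊏ y → y ≡ root
  above⇒root {x} {y} x⊏y with y ≟ᶠ root | minimal-element-below P x
  ... | yes y≡root | _ = y≡root
  ... | no y≢root  | l , l≤x , l-min =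
    contradiction (l⊏y , below-root y≢root)
                  (proj₂ (maximal-covers-leaves root root-maximal l l-min (proj₂ l⊏root)) y)
    where
      below-x⇒below-y : ∀ {t} → x ≡ t ⊎ t ⊏ x → t ⊏ y
      below-x⇒below-y (inj₁ refl) = x⊏y
      below-x⇒below-y (inj₂ t⊏x)  = <ₚ-trans P t⊏x x⊏y
      l⊏y : l ⊏ y
      l⊏y = below-x⇒below-y l≤x
      l⊏root : l ⊏ root
      l⊏root = <ₚ-trans P l⊏y (below-root y≢root)

-- Promotion on a rooted star

module _ {n : ℕ} (i j : Fin n) where

  transpose-matchˡ : transpose i j i ≡ j
  transpose-matchˡ rewrite dec-true (i ≟ᶠ i) refl = refl

  transpose-matchʳ : transpose i j j ≡ i
  transpose-matchʳ with j ≟ᶠ i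
  ... | yes refl = refl
  ... | no _     rewrite dec-true (j ≟ᶠ j) refl = refl

  transpose-mismatch : ∀ {k} → k ≢ i → k ≢ j → transpose i j k ≡ k
  transpose-mismatch {k} k≢i k≢j rewrite dec-false (k ≟ᶠ i) k≢i | dec-false (k ≟ᶠ j) k≢j = refl

  transpose-injective : Injective _≡_ _≡_ (transpose i j)
  transpose-injective e =
    trans (sym (transpose-inverse j i)) (trans (cong (transpose j i) e) (transpose-inverse j i))

pred-injective : ∀ {m} {i j : Fin (suc m)} → i ≢ zero → j ≢ zero → pred i ≡ pred j → i ≡ j
pred-injective {i = zero}  i≢0 _   _ = contradiction refl i≢0
pred-injective {j = zero}  _   j≢0 _ = contradiction refl j≢0
pred-injective {i = suc i} {suc j} _ _ e = cong suc (inject₁-injective e)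

pred≢fromℕ : ∀ {m} {i : Fin (suc m)} → i ≢ zero → pred i ≢ fromℕ m
pred≢fromℕ {i = zero}  i≢0 = contradiction refl i≢0
pred≢fromℕ {i = suc i} _   = fromℕ≢inject₁ ∘ sym

module StarPromotion {m : ℕ} (P : FinPoset (suc m)) (star : IsRootedStar P) (L : Labeling (suc m)) where
  open RootedStar P star
  open ≡-Reasoning
  open Promotion P L using (label; argminLabel; next; chainFrom; chain; newLabel; v₁)

  private
    argminLabel-const : ∀ {a xs} → a ∈ xs → All (_≡ a) xs → argminLabel xs ≡ just a
    argminLabel-const {xs = _ ∷ []} _ (refl ∷ []) = refl
    argminLabel-const {a} {_ ∷ y ∷ ys} _ (refl ∷ y≡a ∷ ys≡a)
      with argminLabel (y ∷ ys) | argminLabel-const (here (sym y≡a)) (y≡a ∷ ys≡a)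
    ... | just _ | refl = if-eta (does (label a <? label a))

    next-root : next root ≡ nothing
    next-root = cong argminLabel (filter-none (T? ∘ aboveᵇ P root) {xs = allFin (suc m)}
      (All.tabulate (λ {y} _ → root-maximal y ∘ aboveᵇ-sound P)))

    next-nonroot : ∀ {x} → x ≢ root → next x ≡ just root
    next-nonroot {x} x≢root = argminLabel-const
      (∈-filter⁺ (T? ∘ aboveᵇ P x) (∈-allFin root) (aboveᵇ-complete P (below-root x≢root)))
      (All.map (above⇒root ∘ aboveᵇ-sound P) (all-filter (T? ∘ aboveᵇ P x) (allFin (suc m))))

    chainFrom-root : ∀ k → chainFrom k root ≡ [ root ]
    chainFrom-root zero    = refl
    chainFrom-root (suc k) rewrite next-root = refl

    chainFrom-nonroot : ∀ k {x} → x ≢ root → chainFrom (suc k) x ≡ x ∷ [ root ]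
    chainFrom-nonroot k x≢root rewrite next-nonroot x≢root = cong (_ ∷_) (chainFrom-root k)

    newLabel-[w]-w : ∀ w → newLabel [ w ] w ≡ fromℕ m
    newLabel-[w]-w w rewrite dec-true (w ≟ᶠ w) refl = refl

    newLabel-[w] : ∀ {w x} → x ≢ w → newLabel [ w ] x ≡ pred (label x)
    newLabel-[w] {w} {x} x≢w rewrite dec-false (x ≟ᶠ w) x≢w = refl

    newLabel-[v,w]-v : ∀ v w → newLabel (v ∷ [ w ]) v ≡ pred (label w)
    newLabel-[v,w]-v v w rewrite dec-true (v ≟ᶠ v) refl = refl

    newLabel-[v,w] : ∀ {v w x} → x ≢ v → newLabel (v ∷ [ w ]) x ≡ newLabel [ w ] x
    newLabel-[v,w] {v} {w} {x} x≢v rewrite dec-false (x ≟ᶠ v) x≢v = refl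

    chain≡[root] : v₁ ≡ root → chain ≡ [ root ]
    chain≡[root] v₁≡root = trans (cong (chainFrom (suc m)) v₁≡root) (chainFrom-root (suc m))

    lookup-∂ : ∀ x → lookup (∂ P L) x ≡ newLabel chain x
    lookup-∂ = lookup∘tabulate (newLabel chain)

  promotion-root : lookup (∂ P L) root ≡ fromℕ m
  promotion-root with v₁ ≟ᶠ root
  ... | yes v₁≡root = begin
    lookup (∂ P L) root        ≡⟨ lookup-∂ root ⟩
    newLabel chain root        ≡⟨ cong (λ c → newLabel c root) (chain≡[root] v₁≡root) ⟩
    newLabel [ root ] root     ≡⟨ newLabel-[w]-w root ⟩
    fromℕ m                    ∎
  ... | no v₁≢root = begin
    lookup (∂ P L) root        ≡⟨ lookup-∂ root ⟩
    newLabel chain root        ≡⟨ cong (λ c → newLabel c root) (chainFrom-nonroot m v₁≢root) ⟩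
    newLabel (v₁ ∷ [ root ]) root ≡⟨ newLabel-[v,w] (v₁≢root ∘ sym) ⟩
    newLabel [ root ] root     ≡⟨ newLabel-[w]-w root ⟩
    fromℕ m                    ∎

  -- The promotion chain is v₁, root (or just the root), so only v₁ and the root trade labels.
  promotion-nonroot : ∀ {x} → x ≢ root → lookup (∂ P L) x ≡ pred (lookup L (transpose v₁ root x))
  promotion-nonroot {x} x≢root with v₁ ≟ᶠ root
  ... | yes v₁≡root = begin
    lookup (∂ P L) x           ≡⟨ lookup-∂ x ⟩
    newLabel chain x           ≡⟨ cong (λ c → newLabel c x) (chain≡[root] v₁≡root) ⟩
    newLabel [ root ] x        ≡⟨ newLabel-[w] x≢root ⟩
    pred (label x)
      ≡⟨ cong (pred ∘ label) (transpose-mismatch v₁ root (x≢root ∘ flip trans v₁≡root) x≢root) ⟨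
    pred (label (transpose v₁ root x)) ∎
  ... | no v₁≢root = begin
    lookup (∂ P L) x           ≡⟨ lookup-∂ x ⟩
    newLabel chain x           ≡⟨ cong (λ c → newLabel c x) (chainFrom-nonroot m v₁≢root) ⟩
    newLabel (v₁ ∷ [ root ]) x ≡⟨ via-v₁ (x ≟ᶠ v₁) ⟩
    pred (label (transpose v₁ root x)) ∎
    where
      via-v₁ : Dec (x ≡ v₁) → newLabel (v₁ ∷ [ root ]) x ≡ pred (label (transpose v₁ root x))
      via-v₁ (yes refl) = begin
        newLabel (x ∷ [ root ]) x  ≡⟨ newLabel-[v,w]-v x root ⟩
        pred (label root)          ≡⟨ cong (pred ∘ label) (transpose-matchˡ x root) ⟨
        pred (label (transpose x root x)) ∎
      via-v₁ (no x≢v₁) = begin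
        newLabel (v₁ ∷ [ root ]) x ≡⟨ newLabel-[v,w] x≢v₁ ⟩
        newLabel [ root ] x        ≡⟨ newLabel-[w] x≢root ⟩
        pred (label x)             ≡⟨ cong (pred ∘ label) (transpose-mismatch v₁ root x≢v₁ x≢root) ⟨
        pred (label (transpose v₁ root x)) ∎

-- Fibres of promotion

lookup-≗⇒≡ : ∀ {A : Set} {n} {xs ys : Vec A n} → lookup xs ≗ lookup ys → xs ≡ ys
lookup-≗⇒≡ {xs = xs} {ys} xs≗ys =
  trans (sym (tabulate∘lookup xs)) (trans (tabulate-cong xs≗ys) (tabulate∘lookup ys))

module Fibres {m : ℕ} (P : FinPoset (suc m)) (star : IsRootedStar P) where
  open RootedStar P star
  open StarPromotion P star
  open Promotion P using (v₁)
  open ≡-Reasoning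

  private
    N : ℕ
    N = suc m

  v₁-labelled-zero : ∀ {L} → L ∈ Λ P → lookup L (v₁ L) ≡ zero
  v₁-labelled-zero {L} L∈Λ with x₀ , Lx₀≡0 ← injective⇒surjective (∈Λ⇒injective P L∈Λ) zero
    with filter (λ x → lookup L x ≟ᶠ zero) (allFin N)
       | all-filter (λ x → lookup L x ≟ᶠ zero) (allFin N)
       | ∈-filter⁺ (λ x → lookup L x ≟ᶠ zero) (∈-allFin x₀) Lx₀≡0
  ... | y ∷ _ | Ly≡0 ∷ _ | _ = Ly≡0

  labelled-zero⇒v₁ : ∀ {L x} → L ∈ Λ P → lookup L x ≡ zero → x ≡ v₁ L
  labelled-zero⇒v₁ L∈Λ Lx≡0 = ∈Λ⇒injective P L∈Λ (trans Lx≡0 (sym (v₁-labelled-zero L∈Λ)))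

  transposed-label≢zero : ∀ {L x} → L ∈ Λ P → x ≢ root → lookup L (transpose (v₁ L) root x) ≢ zero
  transposed-label≢zero {L} {x} L∈Λ x≢root L[σx]≡0 = x≢root (begin
    x                                                 ≡⟨ transpose-inverse root (v₁ L) ⟨
    transpose root (v₁ L) (transpose (v₁ L) root x)   ≡⟨ cong (transpose root (v₁ L)) (labelled-zero⇒v₁ L∈Λ L[σx]≡0) ⟩
    transpose root (v₁ L) (v₁ L)                      ≡⟨ transpose-matchʳ root (v₁ L) ⟩
    root                                              ∎)

  promotion-∈Λ : ∀ {L} → L ∈ Λ P → ∂ P L ∈ Λ P
  promotion-∈Λ {L} L∈Λ = injective⇒∈Λ P ∂-injective
    where
      ∂-injective : Injective _≡_ _≡_ (lookup (∂ P L))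
      ∂-injective {x} {y} ∂x≡∂y with x ≟ᶠ root | y ≟ᶠ root
      ... | yes refl | yes refl = refl
      ... | yes refl | no y≢root = contradiction
        (trans (sym (promotion-nonroot L y≢root)) (trans (sym ∂x≡∂y) (promotion-root L)))
        (pred≢fromℕ (transposed-label≢zero L∈Λ y≢root))
      ... | no x≢root | yes refl = contradiction
        (trans (sym (promotion-nonroot L x≢root)) (trans ∂x≡∂y (promotion-root L)))
        (pred≢fromℕ (transposed-label≢zero L∈Λ x≢root))
      ... | no x≢root | no y≢root = transpose-injective (v₁ L) root (∈Λ⇒injective P L∈Λ (pred-injective
        (transposed-label≢zero L∈Λ x≢root) (transposed-label≢zero L∈Λ y≢root)
        (trans (sym (promotion-nonroot L x≢root)) (trans ∂x≡∂y (promotion-nonroot L y≢root)))))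

  promotion-v₁-injective : ∀ {L₁ L₂} → L₁ ∈ Λ P → L₂ ∈ Λ P →
    ∂ P L₁ ≡ ∂ P L₂ → v₁ L₁ ≡ v₁ L₂ → L₁ ≡ L₂
  promotion-v₁-injective {L₁} {L₂} L₁∈Λ L₂∈Λ ∂≡ v₁≡ = lookup-≗⇒≡ agree
    where
      w = v₁ L₁
      agree : ∀ x → lookup L₁ x ≡ lookup L₂ x
      agree x with x ≟ᶠ w
      ... | yes refl =
        trans (v₁-labelled-zero L₁∈Λ) (sym (trans (cong (lookup L₂) v₁≡) (v₁-labelled-zero L₂∈Λ)))
      ... | no x≢w = pred-injective (x≢w ∘ labelled-zero⇒v₁ L₁∈Λ)
                                    (x≢w ∘ flip trans (sym v₁≡) ∘ labelled-zero⇒v₁ L₂∈Λ) (begin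
        pred (lookup L₁ x)                         ≡⟨ cong (pred ∘ lookup L₁) (transpose-inverse w root) ⟨
        pred (lookup L₁ (transpose w root z))      ≡⟨ promotion-nonroot L₁ z≢root ⟨
        lookup (∂ P L₁) z                          ≡⟨ cong (λ L → lookup L z) ∂≡ ⟩
        lookup (∂ P L₂) z                          ≡⟨ promotion-nonroot L₂ z≢root ⟩
        pred (lookup L₂ (transpose (v₁ L₂) root z)) ≡⟨ cong (λ v → pred (lookup L₂ (transpose v root z))) v₁≡ ⟨
        pred (lookup L₂ (transpose w root z))      ≡⟨ cong (pred ∘ lookup L₂) (transpose-inverse w root) ⟩
        pred (lookup L₂ x)                         ∎)
        where
          z = transpose root w x
          z≢root : z ≢ root
          z≢root z≡root = x≢w (begin
            x                      ≡⟨ transpose-inverse w root ⟨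
            transpose w root z     ≡⟨ cong (transpose w root) z≡root ⟩
            transpose w root root  ≡⟨ transpose-matchʳ w root ⟩
            w                      ∎)

  -- The labeling of the fibre of ∂ L whose label 1 sits at u.
  relabel : Labeling N → Fin N → Labeling N
  relabel L u = tabulate (lookup L ∘ transpose (v₁ L) root ∘ transpose root u)

  module _ {L} (L∈Λ : L ∈ Λ P) (u : Fin N) where

    private
      lookup-relabel : ∀ x → lookup (relabel L u) x ≡ lookup L (transpose (v₁ L) root (transpose root u x))
      lookup-relabel = lookup∘tabulate (lookup L ∘ transpose (v₁ L) root ∘ transpose root u)

    relabel-∈Λ : relabel L u ∈ Λ P
    relabel-∈Λ = injective⇒∈Λ P λ {x} {y} e →
      transpose-injective root u (transpose-injective (v₁ L) root
        (∈Λ⇒injective P L∈Λ (trans (sym (lookup-relabel x)) (trans e (lookup-relabel y)))))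

    v₁-relabel : v₁ (relabel L u) ≡ u
    v₁-relabel = sym (labelled-zero⇒v₁ relabel-∈Λ (begin
      lookup (relabel L u) u
        ≡⟨ lookup-relabel u ⟩
      lookup L (transpose (v₁ L) root (transpose root u u))
        ≡⟨ cong (lookup L ∘ transpose (v₁ L) root) (transpose-matchʳ root u) ⟩
      lookup L (transpose (v₁ L) root root)                 ≡⟨ cong (lookup L) (transpose-matchʳ (v₁ L) root) ⟩
      lookup L (v₁ L)                                       ≡⟨ v₁-labelled-zero L∈Λ ⟩
      zero                                                  ∎))

    promotion-relabel : ∂ P (relabel L u) ≡ ∂ P L
    promotion-relabel = lookup-≗⇒≡ agree
      where
        agree : ∀ x → lookup (∂ P (relabel L u)) x ≡ lookup (∂ P L) x
        agree x with x ≟ᶠ root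
        ... | yes refl = trans (promotion-root (relabel L u)) (sym (promotion-root L))
        ... | no x≢root = begin
          lookup (∂ P (relabel L u)) x
            ≡⟨ promotion-nonroot (relabel L u) x≢root ⟩
          pred (lookup (relabel L u) (transpose (v₁ (relabel L u)) root x))
            ≡⟨ cong (λ v → pred (lookup (relabel L u) (transpose v root x))) v₁-relabel ⟩
          pred (lookup (relabel L u) (transpose u root x))
            ≡⟨ cong pred (lookup-relabel (transpose u root x)) ⟩
          pred (lookup L (transpose (v₁ L) root (transpose root u (transpose u root x))))
            ≡⟨ cong (pred ∘ lookup L ∘ transpose (v₁ L) root) (transpose-inverse root u {x}) ⟩
          pred (lookup L (transpose (v₁ L) root x))
            ≡⟨ promotion-nonroot L x≢root ⟨
          lookup (∂ P L) x
            ∎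

  private
    same-promotion? : ∀ L L′ → Dec (∂ P L′ ≡ ∂ P L)
    same-promotion? L L′ = ≡-dec _≟ᶠ_ (∂ P L′) (∂ P L)

  fibre : Labeling N → List (Labeling N)
  fibre L = filter (same-promotion? L) (Λ P)

  fibre-size : ∀ {L} → L ∈ Λ P → length (fibre L) ≡ N
  fibre-size {L} L∈Λ = begin
    length (fibre L)
      ≡⟨ length-≡-Unique fibre-unique relabelings-unique fibre⊆relabelings relabelings⊆fibre ⟩
    length (map (relabel L) (allFin N))     ≡⟨ length-map (relabel L) (allFin N) ⟩
    length (allFin N)                       ≡⟨ length-tabulate (λ i → i) ⟩
    N                                       ∎
    where
      fibre-unique : Unique (fibre L)
      fibre-unique = filter⁺ (same-promotion? L) (Λ-unique P)
      relabelings-unique : Unique (map (relabel L) (allFin N))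
      relabelings-unique = map⁺ (λ {u} {u′} e →
        trans (sym (v₁-relabel L∈Λ u)) (trans (cong v₁ e) (v₁-relabel L∈Λ u′))) (allFin⁺ N)
      fibre⊆relabelings : fibre L ⊆ map (relabel L) (allFin N)
      fibre⊆relabelings {L′} L′∈fibre
        with L′∈Λ , ∂L′≡∂L ← ∈-filter⁻ (same-promotion? L) {xs = Λ P} L′∈fibre =
        subst (_∈ map (relabel L) (allFin N))
          (promotion-v₁-injective (relabel-∈Λ L∈Λ u) L′∈Λ
            (trans (promotion-relabel L∈Λ u) (sym ∂L′≡∂L)) (v₁-relabel L∈Λ u))
          (∈-map⁺ (relabel L) (∈-allFin u))
        where u = v₁ L′
      relabelings⊆fibre : map (relabel L) (allFin N) ⊆ fibre L
      relabelings⊆fibre L′∈ with u , _ , refl ← ∈-map⁻ (relabel L) {xs = allFin N} L′∈ =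
        ∈-filter⁺ (same-promotion? L) (relabel-∈Λ L∈Λ u) (promotion-relabel L∈Λ u)

corollary3p6 : (n : ℕ) (P : FinPoset n) → IsRootedStar P → degPromotion P ≡ (+ n) / 1
corollary3p6 zero    P ((((() , _) , _) , _))
corollary3p6 (suc m) P star =
  deg-constant-fibres (≡-dec _≟ᶠ_) (Λ-unique P) promotion-∈Λ fibre-size (id∈Λ P)
  where open Fibres P star
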